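{- For every $r\in\mathbb{N}$, the perfect binary tree $T_{r,2}$ is an AR-graph.
   Context: All graphs are finite, simple and undirected; $\mathbb{N}=\{1,2,3,\dots\}$. For $t\ge 2$ and $r\ge 1$, the perfect $t$-ary tree $T_{r,t}$ is the rooted tree in which every interior (non-leaf) vertex has exactly $t$ children and all leaves have depth $r$ (the depth of a vertex is the number of edges on the path from the root to it); $T_{r,2}$ is the perfect binary tree. Let $f:E(G)\to\mathbb{N}$ be an injective edge labeling of a graph $G$. A vertex $v$ is an AR-vertex (under $f$) if, whenever $x_1,\dots,x_k$ are the labels of the $k$ edges incident on $v$, the $2^k$ sums $\sum_{i\in S}x_i$ over all subsets $S\subseteq\{1,\dots,k\}$ are pairwise distinct. An injective labeling $f$ is an AR-labeling if every vertex is an AR-vertex under $f$. A graph $G$ with $m$ edges is an AR-graph if it has an AR-labeling $f:E(G)\to\{1,2,\dots,m\}$. -}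

module Defs where

open import Data.Nat using (ℕ; zero; suc; _+_; _∸_; _^_; _≤_; _<_)
open import Data.Nat.DivMod using (_/_)
open import Data.Fin using (Fin; toℕ)
import Data.Fin as F
open import Data.Fin.Subset using (Subset; _∈_)
open import Data.Vec using (_∷_; [])
open import Data.Bool using (Bool; true; false)
open import Data.Product using (Σ; _×_; _,_; proj₁; proj₂)
open import Data.Sum using (_⊎_)
open import Function.Definitions using (Injective)
open import Relation.Binary.PropositionalEquality using (_≡_)

-- A finite graph given by its number of vertices (vertices are the naturals
-- 0 … nV-1), its number of edges, and the two endpoints of each edge.
record Graph : Set where
  field
    nV   : ℕ
    nE   : ℕ
    ends : Fin nE → ℕ × ℕ

open Graph public

Incident : (G : Graph) → ℕ → Fin (nE G) → Set
Incident G v e = proj₁ (ends G e) ≡ v ⊎ proj₂ (ends G e) ≡ v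

subsetSum : {m : ℕ} → (Fin m → ℕ) → Subset m → ℕ
subsetSum {zero}  f []      = 0
subsetSum {suc m} f (true  ∷ S) = f F.zero + subsetSum (λ i → f (F.suc i)) S
subsetSum {suc m} f (false ∷ S) = subsetSum (λ i → f (F.suc i)) S

IncSubset : (G : Graph) → ℕ → Subset (nE G) → Set
IncSubset G v S = ∀ e → e ∈ S → Incident G v e

ARVertex : (G : Graph) → (Fin (nE G) → ℕ) → ℕ → Set
ARVertex G f v = ∀ S T → IncSubset G v S → IncSubset G v T →
                 subsetSum f S ≡ subsetSum f T → S ≡ T

IsARLabeling : (G : Graph) → (Fin (nE G) → ℕ) → Set
IsARLabeling G f = Injective _≡_ _≡_ f × (∀ v → v < nV G → ARVertex G f v)

IsARGraph : Graph → Set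
IsARGraph G = Σ (Fin (nE G) → ℕ) λ f →
  (∀ e → 1 ≤ f e × f e ≤ nE G) × IsARLabeling G f

-- Perfect binary tree T_{r,2} in heap numbering: vertices 0 … 2^(r+1)-2,
-- root 0, children of i are 2i+1 and 2i+2.  Edge e joins vertex e+1 to its
-- parent ⌊e/2⌋; there are 2^(r+1)-2 edges.
perfectBinaryTree : ℕ → Graph
perfectBinaryTree r = record
  { nV   = 2 ^ suc r ∸ 1
  ; nE   = 2 ^ suc r ∸ 2
  ; ends = λ e → (suc (toℕ e) , toℕ e / 2)
  }

-- Give edge q of the heap-ordered tree with m edges the label q+2, except the last
-- edge, which gets 1. A vertex v ≥ 1 then sees the labels v+1, 2v+2 and 2v+3 (or 1 when
-- 2v+1 is the last edge), and such a triple is dissociated, i.e. its eight subset sums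
-- are distinct, because the labels are positive, distinct and none is the sum of the
-- other two. The root and the vertices with fewer children see positive distinct labels,
-- which suffices. A set of edges at v has the same label sum as its restriction to the
-- positions of the incident edges, so v is an AR-vertex once its labels are dissociated.
module Submission where

open import Defs
open import Data.Bool using (true; false)
open import Data.Empty using (⊥-elim)
open import Data.Fin as Fin using (Fin; toℕ; fromℕ<)
open import Data.Fin.Properties using (toℕ-injective; toℕ-fromℕ<; toℕ<n)
open import Data.Fin.Subset using (Subset; _∈_; _⊆_; ⊥; ⁅_⁆; Empty)
open import Data.Fin.Subset.Properties using (⊆-antisym; Empty-unique)
open import Data.Nat
  using (ℕ; zero; suc; _+_; _*_; _∸_; _^_; _≤_; _<_; z≤n; s≤s; _≟_; _<?_)
open import Data.Nat.Properties
open import Data.Nat.DivMod using (_/_; _%_; m≡m%n+[m/n]*n; m%n<n)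
open import Data.Product using (_,_)
open import Data.Sum using (_⊎_; inj₁; inj₂)
open import Data.Vec using (Vec; []; _∷_; lookup; map; _[_]≔_)
open import Data.Vec.Properties
  using (∷-injectiveˡ; ∷-injectiveʳ; lookup∘update; lookup∘update′; []≔-lookup;
         []=⇒lookup; lookup⇒[]=)
open import Data.Vec.Membership.Propositional renaming (_∈_ to _∈ᵛ_)
open import Data.Vec.Relation.Unary.Any using (here; there)
open import Data.Vec.Relation.Unary.All as All using (All; []; _∷_)
open import Data.Vec.Relation.Unary.All.Properties using (lookup⁻; map⁻)
open import Data.Vec.Relation.Unary.AllPairs using ([]; _∷_)
open import Data.Vec.Relation.Unary.Unique.Propositional using (Unique)
open import Function using (_∘_)
open import Function.Definitions using (Injective)
open import Relation.Nullary using (yes; no)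
open import Relation.Binary.PropositionalEquality
open ≡-Reasoning

open import Algebra.Properties.CommutativeSemigroup +-commutativeSemigroup
  using (x∙yz≈y∙xz)

subsetSum-⊥ : ∀ {n} (f : Fin n → ℕ) → subsetSum f ⊥ ≡ 0
subsetSum-⊥ {zero}  f = refl
subsetSum-⊥ {suc n} f = subsetSum-⊥ (f ∘ Fin.suc)

subsetSum-⁅⁆ : ∀ {n} (f : Fin n → ℕ) (i : Fin n) → subsetSum f ⁅ i ⁆ ≡ f i
subsetSum-⁅⁆ f Fin.zero    = trans (cong (f Fin.zero +_) (subsetSum-⊥ (f ∘ Fin.suc))) (+-identityʳ _)
subsetSum-⁅⁆ f (Fin.suc i) = subsetSum-⁅⁆ (f ∘ Fin.suc) i

subsetSum-insert : ∀ {n} (f : Fin n → ℕ) (S : Subset n) (p : Fin n) →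
                   subsetSum f (S [ p ]≔ true) ≡ f p + subsetSum f (S [ p ]≔ false)
subsetSum-insert f (b ∷ S)     Fin.zero    = refl
subsetSum-insert f (true ∷ S)  (Fin.suc p) =
  trans (cong (f Fin.zero +_) (subsetSum-insert (f ∘ Fin.suc) S p))
        (x∙yz≈y∙xz (f Fin.zero) (f (Fin.suc p)) _)
subsetSum-insert f (false ∷ S) (Fin.suc p) = subsetSum-insert (f ∘ Fin.suc) S p

Dissociated : ∀ {k} → Vec ℕ k → Set
Dissociated xs = Injective _≡_ _≡_ (subsetSum (lookup xs))

dissociated-unique : ∀ {k} {xs : Vec ℕ k} → Dissociated xs → Unique xs
dissociated-unique {xs = []}     d = []
dissociated-unique {xs = x ∷ xs} d = lookup⁻ x∉xs ∷ dissociated-unique tail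
  where
  tail : Dissociated xs
  tail eq = ∷-injectiveʳ (d {false ∷ _} {false ∷ _} eq)

  x∉xs : ∀ i → x ≢ lookup xs i
  x∉xs i x≡xᵢ
    with () ← d {true ∷ ⊥} {false ∷ ⁅ i ⁆}
                (trans (cong (x +_) (subsetSum-⊥ (lookup xs)))
                (trans (+-identityʳ x) (trans x≡xᵢ (sym (subsetSum-⁅⁆ (lookup xs) i)))))

dissociated-[] : Dissociated []
dissociated-[] {[]} {[]} _ = refl

dissociated-∷ : ∀ {k x} {xs : Vec ℕ k} → Dissociated xs →
                (∀ S T → x + subsetSum (lookup xs) S ≢ subsetSum (lookup xs) T) →
                Dissociated (x ∷ xs)
dissociated-∷ {x = x} d new {true  ∷ S} {true  ∷ T} eq = cong (true ∷_) (d (+-cancelˡ-≡ x _ _ eq))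
dissociated-∷         d new {true  ∷ S} {false ∷ T} eq = ⊥-elim (new S T eq)
dissociated-∷         d new {false ∷ S} {true  ∷ T} eq = ⊥-elim (new T S (sym eq))
dissociated-∷         d new {false ∷ S} {false ∷ T} eq = cong (false ∷_) (d eq)

dissociated-1 : ∀ {x} → 0 < x → Dissociated (x ∷ [])
dissociated-1 {x} 0<x = dissociated-∷ dissociated-[] λ where
  [] [] x+0≡0 → >⇒≢ 0<x (m+n≡0⇒m≡0 x x+0≡0)

dissociated-2 : ∀ {x y} → 0 < x → 0 < y → x ≢ y → Dissociated (x ∷ y ∷ [])
dissociated-2 {x} {y} 0<x 0<y x≢y = dissociated-∷ (dissociated-1 0<y) λ where
  (false ∷ []) (false ∷ []) eq → >⇒≢ 0<x (m+n≡0⇒m≡0 x eq)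
  (false ∷ []) (true  ∷ []) eq → x≢y (+-cancelʳ-≡ 0 x y eq)
  (true  ∷ []) (false ∷ []) eq → >⇒≢ 0<x (m+n≡0⇒m≡0 x eq)
  (true  ∷ []) (true  ∷ []) eq → >⇒≢ 0<x (+-cancelʳ-≡ (y + 0) x 0 eq)

-- The head z exceeds every subset sum of (y, x) except y + x, and z + s = y + x forces s = 0.
dissociated-3 : ∀ {x y z} → 0 < x → x < y → y < z → x + y ≢ z → Dissociated (z ∷ y ∷ x ∷ [])
dissociated-3 {x} {y} {z} 0<x x<y y<z x+y≢z =
  dissociated-∷ (dissociated-2 (<-trans 0<x x<y) 0<x (>⇒≢ x<y)) new
  where
  below : ∀ {s t} → t ≤ y → z + s ≢ t
  below {s} t≤y = >⇒≢ (≤-<-trans t≤y (<-≤-trans y<z (m≤m+n z s)))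

  above : ∀ {s} → x ≤ s → z + s ≢ y + (x + 0)
  above {s} x≤s = >⇒≢ (subst (_< z + s) (cong (y +_) (sym (+-identityʳ x))) (+-mono-<-≤ y<z x≤s))

  new : ∀ S T → z + subsetSum (lookup (y ∷ x ∷ [])) S ≢ subsetSum (lookup (y ∷ x ∷ [])) T
  new S (false ∷ false ∷ []) = below z≤n
  new S (false ∷ true  ∷ []) = below (≤-trans (≤-reflexive (+-identityʳ x)) (<⇒≤ x<y))
  new S (true  ∷ false ∷ []) = below (≤-reflexive (+-identityʳ y))
  new (false ∷ false ∷ []) (true ∷ true ∷ []) eq =
    x+y≢z (trans (+-comm x y) (trans (cong (y +_) (sym (+-identityʳ x))) (trans (sym eq) (+-identityʳ z))))
  new (false ∷ true  ∷ []) (true ∷ true ∷ []) = above (≤-reflexive (sym (+-identityʳ x)))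
  new (true  ∷ false ∷ []) (true ∷ true ∷ []) = above (<⇒≤ (subst (x <_) (sym (+-identityʳ y)) x<y))
  new (true  ∷ true  ∷ []) (true ∷ true ∷ []) = above (≤-trans (m≤m+n x 0) (m≤n+m (x + 0) y))

Supported : ∀ {n k} → Subset n → Vec (Fin n) k → Set
Supported S ps = ∀ {e} → e ∈ S → e ∈ᵛ ps

restrict : ∀ {n k} → Subset n → Vec (Fin n) k → Subset k
restrict S ps = map (lookup S) ps

map-≡⇒≡-at : ∀ {A B : Set} {g h : A → B} {k} {xs : Vec A k} {x} →
             map g xs ≡ map h xs → x ∈ᵛ xs → g x ≡ h x
map-≡⇒≡-at eq (here refl)  = ∷-injectiveˡ eq
map-≡⇒≡-at eq (there x∈xs) = map-≡⇒≡-at (∷-injectiveʳ eq) x∈xs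

restrict-⊆ : ∀ {n k} {S T : Subset n} {ps : Vec (Fin n) k} →
             Supported S ps → restrict S ps ≡ restrict T ps → S ⊆ T
restrict-⊆ {S = S} {T} sup eq {e} e∈S =
  lookup⇒[]= e T (trans (sym (map-≡⇒≡-at eq (sup e∈S))) ([]=⇒lookup e∈S))

restrict-injective : ∀ {n k} {S T : Subset n} {ps : Vec (Fin n) k} →
                     Supported S ps → Supported T ps → restrict S ps ≡ restrict T ps → S ≡ T
restrict-injective supS supT eq = ⊆-antisym (restrict-⊆ supS eq) (restrict-⊆ supT (sym eq))

[]≔-lookup′ : ∀ {A : Set} {n} (xs : Vec A n) {i x} → lookup xs i ≡ x → xs [ i ]≔ x ≡ xs
[]≔-lookup′ xs {i} refl = []≔-lookup xs i

erase-supported : ∀ {n k} {S : Subset n} {p} {ps : Vec (Fin n) k} →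
                  Supported S (p ∷ ps) → Supported (S [ p ]≔ false) ps
erase-supported {S = S} {p} sup {e} e∈S′ with e Fin.≟ p
... | yes refl with () ← trans (sym ([]=⇒lookup e∈S′)) (lookup∘update p S false)
... | no e≢p with sup (lookup⇒[]= e S (trans (sym (lookup∘update′ e≢p S false)) ([]=⇒lookup e∈S′)))
...   | here e≡p   = ⊥-elim (e≢p e≡p)
...   | there e∈ps = e∈ps

restrict-erase : ∀ {n k} (S : Subset n) {p} {ps : Vec (Fin n) k} →
                 All (p ≢_) ps → restrict (S [ p ]≔ false) ps ≡ restrict S ps
restrict-erase S []              = refl
restrict-erase S (p≢q ∷ p≢qs) = cong₂ _∷_ (lookup∘update′ (p≢q ∘ sym) S false) (restrict-erase S p≢qs)

subsetSum-restrict : ∀ {n k} (f : Fin n → ℕ) {S : Subset n} {ps : Vec (Fin n) k} →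
                     Unique (map f ps) → Supported S ps →
                     subsetSum f S ≡ subsetSum (lookup (map f ps)) (restrict S ps)
subsetSum-restrict f {S} {[]} _ sup = trans (cong (subsetSum f) (Empty-unique empty)) (subsetSum-⊥ f)
  where
  empty : Empty S
  empty (_ , e∈S) with () ← sup e∈S
subsetSum-restrict f {S} {p ∷ ps} (fp∉fps ∷ distinct) sup = by-bit (lookup S p) refl
  where
  p∉ps : All (p ≢_) ps
  p∉ps = All.map (λ fp≢fq p≡q → fp≢fq (cong f p≡q)) (map⁻ fp∉fps)

  erased : subsetSum f (S [ p ]≔ false) ≡ subsetSum (lookup (map f ps)) (restrict S ps)
  erased = trans (subsetSum-restrict f distinct (erase-supported sup))
                 (cong (subsetSum (lookup (map f ps))) (restrict-erase S p∉ps))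

  by-bit : ∀ b → lookup S p ≡ b →
           subsetSum f S ≡ subsetSum (lookup (map f (p ∷ ps))) (b ∷ restrict S ps)
  by-bit true Sp = begin
    subsetSum f S                      ≡⟨ cong (subsetSum f) ([]≔-lookup′ S Sp) ⟨
    subsetSum f (S [ p ]≔ true)        ≡⟨ subsetSum-insert f S p ⟩
    f p + subsetSum f (S [ p ]≔ false) ≡⟨ cong (f p +_) erased ⟩
    f p + subsetSum (lookup (map f ps)) (restrict S ps) ∎
  by-bit false Sp = trans (cong (subsetSum f) (sym ([]≔-lookup′ S Sp))) erased

supported-ARVertex : (G : Graph) (f : Fin (nE G) → ℕ) {v k : ℕ} (ps : Vec (Fin (nE G)) k) →
                     Dissociated (map f ps) → (∀ S → IncSubset G v S → Supported S ps) →
                     ARVertex G f v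
supported-ARVertex G f ps dissociated supported S T S-inc T-inc eq =
  restrict-injective supS supT (dissociated (begin
    subsetSum (lookup (map f ps)) (restrict S ps) ≡⟨ subsetSum-restrict f distinct supS ⟨
    subsetSum f S                                 ≡⟨ eq ⟩
    subsetSum f T                                 ≡⟨ subsetSum-restrict f distinct supT ⟩
    subsetSum (lookup (map f ps)) (restrict T ps) ∎))
  where
  distinct : Unique (map f ps)
  distinct = dissociated-unique dissociated
  supS : Supported S ps
  supS = supported S S-inc
  supT : Supported T ps
  supT = supported T T-inc

heapTree : ℕ → Graph
heapTree m = record { nV = suc m ; nE = m ; ends = λ e → suc (toℕ e) , toℕ e / 2 }

*2≡+ : ∀ n → n * 2 ≡ n + n
*2≡+ n = trans (*-suc n 1) (cong (n +_) (*-identityʳ n))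

/2-parity : ∀ q → q ≡ q / 2 + q / 2 ⊎ q ≡ suc (q / 2 + q / 2)
/2-parity q with q % 2 | m%n<n q 2 | m≡m%n+[m/n]*n q 2
... | 0           | _                | q≡ = inj₁ (trans q≡ (*2≡+ (q / 2)))
... | 1           | _                | q≡ = inj₂ (trans q≡ (cong suc (*2≡+ (q / 2))))
... | suc (suc _) | s≤s (s≤s ())     | _

heapTree-incident : ∀ {m v} {e : Fin m} → Incident (heapTree m) v e →
                    suc (toℕ e) ≡ v ⊎ toℕ e ≡ v + v ⊎ toℕ e ≡ suc (v + v)
heapTree-incident         (inj₁ e-child)  = inj₁ e-child
heapTree-incident {e = e} (inj₂ refl)     = inj₂ (/2-parity (toℕ e))

heapLabel : ℕ → ℕ → ℕ
heapLabel m q with suc q ≟ m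
... | yes _ = 1
... | no  _ = suc (suc q)

heapLabeling : (m : ℕ) → Fin m → ℕ
heapLabeling m e = heapLabel m (toℕ e)

module HeapTree (m : ℕ) where

  heapLabel-last : ∀ {q} → suc q ≡ m → heapLabel m q ≡ 1
  heapLabel-last {q} last with suc q ≟ m
  ... | yes _   = refl
  ... | no  ¬last = ⊥-elim (¬last last)

  heapLabel-inner : ∀ {q} → suc q ≢ m → heapLabel m q ≡ suc (suc q)
  heapLabel-inner {q} ¬last with suc q ≟ m
  ... | yes last = ⊥-elim (¬last last)
  ... | no  _    = refl

  heapLabel-positive : ∀ {q} → 0 < heapLabel m q
  heapLabel-positive {q} with suc q ≟ m
  ... | yes _ = s≤s z≤n
  ... | no  _ = s≤s z≤n

  heapLabel-≤ : ∀ {q} → q < m → heapLabel m q ≤ m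
  heapLabel-≤ {q} q<m with suc q ≟ m
  ... | yes _     = ≤-trans (s≤s z≤n) q<m
  ... | no  ¬last = ≤∧≢⇒< q<m ¬last

  heapLabel-injective : ∀ {p q} → heapLabel m p ≡ heapLabel m q → p ≡ q
  heapLabel-injective {p} {q} eq with suc p ≟ m | suc q ≟ m
  ... | yes p-last | yes q-last = suc-injective (trans p-last (sym q-last))
  ... | yes _      | no  _      with () ← eq
  ... | no  _      | yes _      with () ← eq
  ... | no  _      | no  _      = suc-injective (suc-injective eq)

  heapLabeling-injective : Injective _≡_ _≡_ (heapLabeling m)
  heapLabeling-injective eq = toℕ-injective (heapLabel-injective eq)

  slot-label : ∀ {q} (q<m : q < m) → heapLabeling m (fromℕ< q<m) ≡ heapLabel m q
  slot-label q<m = cong (heapLabel m) (toℕ-fromℕ< q<m)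

  slot-labels-≢ : ∀ {p q} (p<m : p < m) (q<m : q < m) → p ≢ q →
                  heapLabeling m (fromℕ< p<m) ≢ heapLabeling m (fromℕ< q<m)
  slot-labels-≢ p<m q<m p≢q eq =
    p≢q (heapLabel-injective (trans (sym (slot-label p<m)) (trans eq (slot-label q<m))))

  module _ {k} {ps : Vec (Fin m) k} where

    slot-∈ : ∀ {q} (q<m : q < m) → fromℕ< q<m ∈ᵛ ps → ∀ {e} → toℕ e ≡ q → e ∈ᵛ ps
    slot-∈ q<m q∈ps e≡q = subst (_∈ᵛ ps) (sym (toℕ-injective (trans e≡q (sym (toℕ-fromℕ< q<m))))) q∈ps

    slot-absent : ∀ {q} → m ≤ q → ∀ {e : Fin m} → toℕ e ≡ q → e ∈ᵛ ps
    slot-absent m≤q {e} refl = ⊥-elim (<⇒≱ (toℕ<n e) m≤q)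

    heapTree-supported : ∀ {v} →
      (∀ {e} → suc (toℕ e) ≡ v → e ∈ᵛ ps) →
      (∀ {e} → toℕ e ≡ v + v → e ∈ᵛ ps) →
      (∀ {e} → toℕ e ≡ suc (v + v) → e ∈ᵛ ps) →
      ∀ S → IncSubset (heapTree m) v S → Supported S ps
    heapTree-supported parent left right S incident e∈S with heapTree-incident (incident _ e∈S)
    ... | inj₁ e-parent         = parent e-parent
    ... | inj₂ (inj₁ e-left)  = left e-left
    ... | inj₂ (inj₂ e-right) = right e-right

  slot-label-inner : ∀ {q} (q<m : q < m) → suc q < m → heapLabeling m (fromℕ< q<m) ≡ suc (suc q)
  slot-label-inner q<m 1+q<m = trans (slot-label q<m) (heapLabel-inner (<⇒≢ 1+q<m))

  slot-label-last : ∀ {q} (q<m : q < m) → suc q ≡ m → heapLabeling m (fromℕ< q<m) ≡ 1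
  slot-label-last q<m last = trans (slot-label q<m) (heapLabel-last last)

  root-ARVertex : 2 ≤ m → ARVertex (heapTree m) (heapLabeling m) 0
  root-ARVertex 1<m =
    supported-ARVertex (heapTree m) (heapLabeling m) (fromℕ< 0<m ∷ fromℕ< 1<m ∷ [])
      (dissociated-2 heapLabel-positive heapLabel-positive (slot-labels-≢ 0<m 1<m λ ()))
      (heapTree-supported (λ ()) (slot-∈ 0<m (here refl)) (slot-∈ 1<m (there (here refl))))
    where
    0<m : 0 < m
    0<m = <-trans (s≤s z≤n) 1<m

  childless-ARVertex : ∀ {n} → n < m → m ≤ suc n + suc n → ARVertex (heapTree m) (heapLabeling m) (suc n)
  childless-ARVertex n<m m≤2v =
    supported-ARVertex (heapTree m) (heapLabeling m) (fromℕ< n<m ∷ [])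
      (dissociated-1 heapLabel-positive)
      (heapTree-supported (λ eq → slot-∈ n<m (here refl) (suc-injective eq))
                          (slot-absent m≤2v) (slot-absent (m≤n⇒m≤1+n m≤2v)))

  oneChild-ARVertex : ∀ {n} → suc n + suc n < m → m ≤ suc (suc n + suc n) →
                      ARVertex (heapTree m) (heapLabeling m) (suc n)
  oneChild-ARVertex {n} 2v<m m≤2v+1 =
    supported-ARVertex (heapTree m) (heapLabeling m) (fromℕ< n<m ∷ fromℕ< 2v<m ∷ [])
      (dissociated-2 heapLabel-positive heapLabel-positive (slot-labels-≢ n<m 2v<m (<⇒≢ n<2v)))
      (heapTree-supported (λ eq → slot-∈ n<m (here refl) (suc-injective eq))
                          (slot-∈ 2v<m (there (here refl))) (slot-absent m≤2v+1))
    where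
    n<2v : n < suc n + suc n
    n<2v = s≤s (m≤m+n n (suc n))
    n<m : n < m
    n<m = <-trans n<2v 2v<m

  bothChildren-ARVertex : ∀ {n} → suc (suc (suc n + suc n)) < m →
                         ARVertex (heapTree m) (heapLabeling m) (suc n)
  bothChildren-ARVertex {n} 2v+2<m =
    supported-ARVertex (heapTree m) (heapLabeling m) (fromℕ< 2v+1<m ∷ fromℕ< 2v<m ∷ fromℕ< n<m ∷ [])
      (subst Dissociated (sym labels)
        (dissociated-3 (s≤s z≤n) (s≤s (s≤s (m≤m+n v v))) (n<1+n _)
                       (>⇒≢ (s≤s (m<n+m (suc (suc (v + v))) (s≤s z≤n))))))
      (heapTree-supported (λ eq → slot-∈ n<m (there (there (here refl))) (suc-injective eq))
                          (slot-∈ 2v<m (there (here refl))) (slot-∈ 2v+1<m (here refl)))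
    where
    v : ℕ
    v = suc n
    2v+1<m : suc (v + v) < m
    2v+1<m = <-trans (n<1+n _) 2v+2<m
    2v<m : v + v < m
    2v<m = <-trans (n<1+n _) 2v+1<m
    n<m : n < m
    n<m = <-trans (s≤s (m≤m+n n v)) 2v<m
    labels : map (heapLabeling m) (fromℕ< 2v+1<m ∷ fromℕ< 2v<m ∷ fromℕ< n<m ∷ [])
           ≡ suc (suc (suc (v + v))) ∷ suc (suc (v + v)) ∷ suc v ∷ []
    labels = cong₂ _∷_ (slot-label-inner 2v+1<m 2v+2<m)
            (cong₂ _∷_ (slot-label-inner 2v<m 2v+1<m)
            (cong₂ _∷_ (slot-label-inner n<m (≤-<-trans (m≤m+n v v) 2v<m)) refl))

  bothChildren-lastEdge-ARVertex : ∀ {n} → suc (suc (suc n + suc n)) ≡ m →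
                       ARVertex (heapTree m) (heapLabeling m) (suc n)
  bothChildren-lastEdge-ARVertex {n} last =
    supported-ARVertex (heapTree m) (heapLabeling m) (fromℕ< 2v<m ∷ fromℕ< n<m ∷ fromℕ< 2v+1<m ∷ [])
      (subst Dissociated (sym labels)
        (dissociated-3 (s≤s z≤n) (s≤s (s≤s z≤n)) (s≤s (s≤s (m≤m+n v v)))
                       (λ eq → <⇒≢ (m<m+n v (s≤s z≤n)) (suc-injective (suc-injective eq)))))
      (heapTree-supported (λ eq → slot-∈ n<m (there (here refl)) (suc-injective eq))
                          (slot-∈ 2v<m (here refl)) (slot-∈ 2v+1<m (there (there (here refl)))))
    where
    v : ℕ
    v = suc n
    2v+1<m : suc (v + v) < m
    2v+1<m = ≤-reflexive last
    2v<m : v + v < m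
    2v<m = <-trans (n<1+n _) 2v+1<m
    n<m : n < m
    n<m = <-trans (s≤s (m≤m+n n v)) 2v<m
    labels : map (heapLabeling m) (fromℕ< 2v<m ∷ fromℕ< n<m ∷ fromℕ< 2v+1<m ∷ [])
           ≡ suc (suc (v + v)) ∷ suc v ∷ 1 ∷ []
    labels = cong₂ _∷_ (slot-label-inner 2v<m 2v+1<m)
            (cong₂ _∷_ (slot-label-inner n<m (≤-<-trans (m≤m+n v v) 2v<m))
            (cong₂ _∷_ (slot-label-last 2v+1<m last) refl))

  heapTree-ARVertex : 2 ≤ m → ∀ v → v < suc m → ARVertex (heapTree m) (heapLabeling m) v
  heapTree-ARVertex 1<m zero    _ = root-ARVertex 1<m
  heapTree-ARVertex _   (suc n) (s≤s n<m)
    with suc (suc n + suc n) <? m | suc n + suc n <? m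
  ... | yes 2v+1<m | _ with suc (suc (suc n + suc n)) <? m
  ...   | yes 2v+2<m = bothChildren-ARVertex 2v+2<m
  ...   | no  2v+2≮m = bothChildren-lastEdge-ARVertex (≤-antisym 2v+1<m (≮⇒≥ 2v+2≮m))
  heapTree-ARVertex _ (suc n) (s≤s n<m) | no 2v+1≮m | yes 2v<m = oneChild-ARVertex 2v<m (≮⇒≥ 2v+1≮m)
  heapTree-ARVertex _ (suc n) (s≤s n<m) | no _      | no 2v≮m  = childless-ARVertex n<m (≮⇒≥ 2v≮m)

  heapTree-isARGraph : 2 ≤ m → IsARGraph (heapTree m)
  heapTree-isARGraph 1<m =
    heapLabeling m , (λ e → heapLabel-positive , heapLabel-≤ (toℕ<n e)) ,
    heapLabeling-injective , heapTree-ARVertex 1<m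

open HeapTree using (heapTree-isARGraph)

theorem5 : ∀ (r : ℕ) → 1 ≤ r → IsARGraph (perfectBinaryTree r)
theorem5 r 1≤r =
  let f , bounded , injective , arVertex = heapTree-isARGraph m 2≤m
  in  f , bounded , injective , λ v v<nV → arVertex v (subst (v <_) nV≡1+m v<nV)
  where
  4≤2^[1+r] : 4 ≤ 2 ^ suc r
  4≤2^[1+r] = ^-monoʳ-≤ 2 (s≤s 1≤r)
  m : ℕ
  m = 2 ^ suc r ∸ 2
  2≤m : 2 ≤ m
  2≤m = ∸-monoˡ-≤ 2 4≤2^[1+r]
  nV≡1+m : 2 ^ suc r ∸ 1 ≡ suc m
  nV≡1+m = +-∸-assoc 1 (≤-trans (s≤s (s≤s z≤n)) 4≤2^[1+r])
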